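{- Let $H\le G_{d,k}$. Then $\widetilde{\mathfrak X}_{d,k}(H)$ is upper $k$-regular (every $(d-1)$-multicell is contained in exactly $k$ $d$-multicells) if and only if $$\langle\alpha_i\rangle\cap gHg^{ -1}=\{e\}\qquad\text{for all } i\in[\![d]\!],\ g\in G_{d,k}.$$ In particular, if $H$ is normal in $G_{d,k}$, the multicomplex is upper $k$-regular if and only if $\langle\alpha_i\rangle\cap H=\{e\}$ for every $i\in[\![d]\!]$, which happens if and only if for every $i$ the image of $\alpha_i$ in $G_{d,k}/H$ has order exactly $k$.
   Context: $[\![d]\!]=\{0,\dots,d\}$, $G_{d,k}=\langle\alpha_0,\dots,\alpha_d\mid\alpha_i^k=e\rangle$. For $J\subseteq[\![d]\!]$: $K_J=\langle\alpha_j:j\in J\rangle$, $\widehat J=[\![d]\!]\setminus J$. For $H\le G_{d,k}$, right cosets $K_{\widehat J}g,K_{\widehat{J'}}g'$ are equivalent if $\{K_{\widehat J}gh:h\in H\}=\{K_{\widehat{J'}}g'h:h\in H\}$; $[K_{\widehat J}g]_H$ is the class. The multicomplex $\widetilde{\mathfrak X}_{d,k}(H)$ has the classes $[K_{\widehat J}g]_H$ as multicells (dimension $|J|-1$), with the multiboundary of $[K_{\widehat J}g]_H$ equal to $\{[K_{\widehat{J\setminus\{l\}}}g]_H:l\in J\}$. Thus its $d$-multicells are the classes $[g]_H=gH$, its $(d-1)$-multicells are the classes $[\langle\alpha_i\rangle g]_H$, and a $d$-multicell contains a $(d-1)$-multicell if the latter lies in its multiboundary. -}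

module Defs where

open import Level using (Level; _⊔_)
open import Algebra.Bundles using (Group)
open import Algebra.Morphism.Structures using (module GroupMorphisms)
open import Data.Nat using (ℕ; zero; suc; _<_)
open import Data.Fin using (Fin)
open import Data.Product using (Σ; ∃; _×_; _,_)
open import Relation.Nullary using (¬_)

private
  variable
    c ℓ : Level

module _ (G : Group c ℓ) where
  open Group G

  pow : Carrier → ℕ → Carrier
  pow x zero    = ε
  pow x (suc n) = x ∙ pow x n

-- G together with α : Fin (suc d) → G is a presentation of
-- G_{d,k} = ⟨ α_0 , … , α_d ∣ α_i^k = e ⟩ :
-- the relations hold, and (G , α) is universal: for every group G' and
-- elements β_i with β_i^k = e there is a homomorphism G → G' sending α_i to
-- β_i, and any two homomorphisms agreeing on all α_i agree everywhere.
record IsGdk (G : Group c ℓ) (d k : ℕ) (α : Fin (suc d) → Group.Carrier G)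
             : Set (Level.suc (c ⊔ ℓ)) where
  open Group G
  field
    relation  : ∀ i → pow G (α i) k ≈ ε
    existence : (G' : Group c ℓ) (β : Fin (suc d) → Group.Carrier G') →
                (∀ i → Group._≈_ G' (pow G' (β i) k) (Group.ε G')) →
                Σ (Carrier → Group.Carrier G') λ f →
                  GroupMorphisms.IsGroupHomomorphism (Group.rawGroup G) (Group.rawGroup G') f
                  × (∀ i → Group._≈_ G' (f (α i)) (β i))
    uniqueness : (G' : Group c ℓ) (f f' : Carrier → Group.Carrier G') →
                 GroupMorphisms.IsGroupHomomorphism (Group.rawGroup G) (Group.rawGroup G') f →
                 GroupMorphisms.IsGroupHomomorphism (Group.rawGroup G) (Group.rawGroup G') f' →
                 (∀ i → Group._≈_ G' (f (α i)) (f' (α i))) →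
                 ∀ x → Group._≈_ G' (f x) (f' x)

module _ (G : Group c ℓ) where
  open Group G

  record IsSubgroup {h : Level} (H : Carrier → Set h) : Set (c ⊔ ℓ ⊔ h) where
    field
      resp  : ∀ {x y} → x ≈ y → H x → H y
      ε∈    : H ε
      ∙∈    : ∀ {x y} → H x → H y → H (x ∙ y)
      ⁻¹∈   : ∀ {x} → H x → H (x ⁻¹)

  IsNormal : {h : Level} → (Carrier → Set h) → Set (c ⊔ h)
  IsNormal H = ∀ g x → H x → H (g ∙ x ∙ g ⁻¹)

  -- The cyclic subgroup ⟨a⟩ (a has finite order in G_{d,k}, so
  -- non-negative powers suffice).
  Cyc : Carrier → Carrier → Set ℓ
  Cyc a x = ∃ λ (n : ℕ) → x ≈ pow G a n

  Triv : Carrier → Set ℓ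
  Triv x = x ≈ ε

  RCoset : {p : Level} → (Carrier → Set p) → Carrier → Carrier → Set p
  RCoset K g x = K (x ∙ g ⁻¹)

  _≐_ : {p q : Level} → (Carrier → Set p) → (Carrier → Set q) → Set (c ⊔ p ⊔ q)
  A ≐ B = ∀ x → (A x → B x) × (B x → A x)

  module _ {h : Level} (H : Carrier → Set h) where

    -- K g ~ K' g'  iff  { K g h : h ∈ H } = { K' g' h : h ∈ H } as sets of cosets.
    ClassEq : {p q : Level} → (Carrier → Set p) → Carrier →
              (Carrier → Set q) → Carrier → Set (c ⊔ h ⊔ p ⊔ q)
    ClassEq K g K' g' =
      (∀ x → H x → ∃ λ y → H y × (RCoset K (g ∙ x) ≐ RCoset K' (g' ∙ y)))
      × (∀ y → H y → ∃ λ x → H x × (RCoset K (g ∙ x) ≐ RCoset K' (g' ∙ y)))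

    module _ {d : ℕ} (α : Fin (suc d) → Carrier) where

      -- The d-multicell [g]_H = [K_∅ g]_H contains the (d-1)-multicell
      -- [⟨α_i⟩ g']_H, i.e. the latter is in the multiboundary
      -- { [⟨α_l⟩ g]_H : l ∈ ⟦d⟧ } of the former.
      Contains : Carrier → Fin (suc d) → Carrier → Set (c ⊔ ℓ ⊔ h)
      Contains g i g' = ∃ λ (l : Fin (suc d)) → ClassEq (Cyc (α l)) g (Cyc (α i)) g'

      TopEq : Carrier → Carrier → Set (c ⊔ ℓ ⊔ h)
      TopEq g g' = ClassEq Triv g Triv g'

      ContainedInExactly : ℕ → Fin (suc d) → Carrier → Set (c ⊔ ℓ ⊔ h)
      ContainedInExactly k i g =
        Σ (Fin k → Carrier) λ f →
          (∀ j → Contains (f j) i g)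
          × (∀ j j' → TopEq (f j) (f j') → j ≡ j')
          × (∀ g' → Contains g' i g → ∃ λ j → TopEq g' (f j))
        where open import Relation.Binary.PropositionalEquality using (_≡_)

      UpperRegular : ℕ → Set (c ⊔ ℓ ⊔ h)
      UpperRegular k = ∀ i g → ContainedInExactly k i g

      ConjCondition : Set (c ⊔ ℓ ⊔ h)
      ConjCondition = ∀ i g x → Cyc (α i) x →
                      (∃ λ y → H y × x ≈ g ∙ y ∙ g ⁻¹) → x ≈ ε

      IntersectCondition : Set (c ⊔ ℓ ⊔ h)
      IntersectCondition = ∀ i x → Cyc (α i) x → H x → x ≈ ε

      -- For every i the image α_i H of α_i in G/H has order exactly k:
      -- (α_i H)^k = H and (α_i H)^j ≠ H for 0 < j < k
      -- (in G/H, (α_i H)^j = H iff α_i^j ∈ H).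
      QuotientOrder : ℕ → Set h
      QuotientOrder k = ∀ i → H (pow G (α i) k)
                        × (∀ j → 0 < j → j < k → ¬ H (pow G (α i) j))

-- Write u ∼ v for uH = vH.  The d-multicells [u]_H, [v]_H coincide iff u ∼ v,
-- and the d-multicells containing [⟨α_i⟩ g]_H are exactly the [α_i^m g]_H.
-- If ⟨α_i⟩ meets no conjugate of H, the k cells [α_i^m g]_H (m < k) are
-- pairwise distinct, since α_i has order exactly k in G_{d,k} (it maps to 1
-- in ℤ/k).  Conversely, if α_i^j ∈ g H g⁻¹ with 0 < j < k, then
-- α_i^m g ∼ α_i^(m mod j) g, so at most j < k distinct d-multicells contain
-- [⟨α_i⟩ g]_H.  For normal H the conjugates of H are H itself, and α_i^j ∈ H
-- says that (α_i H)^j is trivial in G/H.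

module Submission where

open import Defs
open import Level using (Level; _⊔_; Lift; lift; lower)
open import Algebra.Bundles using (Group)
open import Algebra.Morphism.Structures using (module GroupMorphisms)
open import Data.Nat using (ℕ; zero; suc; _+_; _*_; _∸_; _%_; _/_; _<_; _≤_; s≤s; z≤n; NonZero; >-nonZero)
import Data.Nat.Properties as ℕ
open import Data.Nat.DivMod
  using (m≡m%n+[m/n]*n; m%n<n; m<n⇒m%n≡m; n%n≡0; m*n%n≡0; %-distribˡ-+; %-distribˡ-*)
open import Data.Fin using (Fin; toℕ; fromℕ<)
import Data.Fin.Properties as Fin
import Data.Fin as Fin using (_<_)
open import Data.Product using (∃; ∃₂; _×_; _,_; proj₁; proj₂)
open import Data.Sum using (_⊎_; inj₁; inj₂)
open import Data.Empty using (⊥-elim)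
open import Function using (_∘_)
open import Function.Bundles using (_⇔_; mk⇔)
open import Relation.Nullary using (¬_)
open import Relation.Binary.Definitions using (tri<; tri≈; tri>)
open import Relation.Binary.PropositionalEquality as ≡ using (_≡_)

private
  variable
    c ℓ h : Level

module PowerProperties (G : Group c ℓ) where
  open Group G
  open import Relation.Binary.Reasoning.Setoid setoid

  pow-cong : ∀ n {x y} → x ≈ y → pow G x n ≈ pow G y n
  pow-cong zero    x≈y = refl
  pow-cong (suc n) x≈y = ∙-cong x≈y (pow-cong n x≈y)

  pow-congˡ : ∀ x {m n} → m ≡ n → pow G x m ≈ pow G x n
  pow-congˡ x ≡.refl = refl

  pow-+ : ∀ x m n → pow G x (m + n) ≈ pow G x m ∙ pow G x n
  pow-+ x zero    n = sym (identityˡ _)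
  pow-+ x (suc m) n = trans (∙-congˡ (pow-+ x m n)) (sym (assoc _ _ _))

  pow-* : ∀ x m n → pow G x (m * n) ≈ pow G (pow G x n) m
  pow-* x zero    n = refl
  pow-* x (suc m) n = trans (pow-+ x n (m * n)) (∙-congˡ (pow-* x m n))

  pow-ε : ∀ n → pow G ε n ≈ ε
  pow-ε zero    = refl
  pow-ε (suc n) = trans (identityˡ _) (pow-ε n)

  pow-divMod : ∀ x n j .{{_ : NonZero j}} →
               pow G x n ≈ pow G x (n % j) ∙ pow G (pow G x j) (n / j)
  pow-divMod x n j = begin
    pow G x n                                   ≈⟨ pow-congˡ x (m≡m%n+[m/n]*n n j) ⟩
    pow G x (n % j + n / j * j)                 ≈⟨ pow-+ x (n % j) (n / j * j) ⟩
    pow G x (n % j) ∙ pow G x (n / j * j)       ≈⟨ ∙-congˡ (pow-* x (n / j) j) ⟩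
    pow G x (n % j) ∙ pow G (pow G x j) (n / j) ∎

  pow-mod : ∀ {x k} .{{_ : NonZero k}} → pow G x k ≈ ε → ∀ n → pow G x n ≈ pow G x (n % k)
  pow-mod {x} {k} xᵏ≈ε n = begin
    pow G x n                                   ≈⟨ pow-divMod x n k ⟩
    pow G x (n % k) ∙ pow G (pow G x k) (n / k) ≈⟨ ∙-congˡ (pow-cong (n / k) xᵏ≈ε) ⟩
    pow G x (n % k) ∙ pow G ε (n / k)           ≈⟨ ∙-congˡ (pow-ε (n / k)) ⟩
    pow G x (n % k) ∙ ε                         ≈⟨ identityʳ _ ⟩
    pow G x (n % k)                             ∎

pow-homo : (G G' : Group c ℓ) {f : Group.Carrier G → Group.Carrier G'} →
           GroupMorphisms.IsGroupHomomorphism (Group.rawGroup G) (Group.rawGroup G') f →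
           ∀ x n → Group._≈_ G' (f (pow G x n)) (pow G' (f x) n)
pow-homo G G' hom x zero    = ε-homo
  where open GroupMorphisms.IsGroupHomomorphism hom
pow-homo G G' hom x (suc n) = Group.trans G' (homo x _) (Group.∙-congˡ G' (pow-homo G G' hom x n))
  where open GroupMorphisms.IsGroupHomomorphism hom

module IntegersModulo (c ℓ : Level) (n : ℕ) where
  private
    k : ℕ
    k = suc n

    +-cong-mod : ∀ a b a' b' → a % k ≡ b % k → a' % k ≡ b' % k → (a + a') % k ≡ (b + b') % k
    +-cong-mod a b a' b' a≡b a'≡b' = begin
      (a + a') % k               ≡⟨ %-distribˡ-+ a a' k ⟩
      (a % k + a' % k) % k       ≡⟨ ≡.cong₂ (λ u v → (u + v) % k) a≡b a'≡b' ⟩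
      (b % k + b' % k) % k       ≡⟨ %-distribˡ-+ b b' k ⟨
      (b + b') % k               ∎
      where open ≡.≡-Reasoning

    *-congʳ-mod : ∀ m a b → a % k ≡ b % k → (m * a) % k ≡ (m * b) % k
    *-congʳ-mod m a b a≡b = begin
      (m * a) % k                ≡⟨ %-distribˡ-* m a k ⟩
      (m % k * (a % k)) % k      ≡⟨ ≡.cong (λ u → (m % k * u) % k) a≡b ⟩
      (m % k * (b % k)) % k      ≡⟨ %-distribˡ-* m b k ⟨
      (m * b) % k                ∎
      where open ≡.≡-Reasoning

    -- a + n * a is definitionally k * a, hence the inverse n * a.
    k*a%k≡0 : ∀ a → (a + n * a) % k ≡ 0
    k*a%k≡0 a = ≡.trans (≡.cong (_% k) (ℕ.*-comm k a)) (m*n%n≡0 a k)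

  ℤ/k : Group c ℓ
  ℤ/k = record
    { Carrier = Lift c ℕ
    ; _≈_     = λ x y → Lift ℓ (lower x % k ≡ lower y % k)
    ; _∙_     = λ x y → lift (lower x + lower y)
    ; ε       = lift 0
    ; _⁻¹     = λ x → lift (n * lower x)
    ; isGroup = record
      { isMonoid = record
        { isSemigroup = record
          { isMagma = record
            { isEquivalence = record
              { refl  = lift ≡.refl
              ; sym   = λ (lift e) → lift (≡.sym e)
              ; trans = λ (lift e) (lift e') → lift (≡.trans e e')
              }
            ; ∙-cong = λ {x} {y} {u} {v} (lift e) (lift e') →
                         lift (+-cong-mod (lower x) (lower y) (lower u) (lower v) e e')
            }
          ; assoc = λ x y z → lift (≡.cong (_% k) (ℕ.+-assoc (lower x) (lower y) (lower z)))
          }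
        ; identity = (λ _ → lift ≡.refl)
                   , (λ x → lift (≡.cong (_% k) (ℕ.+-identityʳ (lower x))))
        }
      ; inverse = (λ x → lift (≡.trans (≡.cong (_% k) (ℕ.+-comm (n * lower x) (lower x)))
                                      (k*a%k≡0 (lower x))))
                , (λ x → lift (k*a%k≡0 (lower x)))
      ; ⁻¹-cong = λ {x} {y} (lift e) → lift (*-congʳ-mod n (lower x) (lower y) e)
      }
    }

  lower-pow-one : ∀ m → lower (pow ℤ/k (lift 1) m) ≡ m
  lower-pow-one zero    = ≡.refl
  lower-pow-one (suc m) = ≡.cong suc (lower-pow-one m)

  pow-one-k : Group._≈_ ℤ/k (pow ℤ/k (lift 1) k) (Group.ε ℤ/k)
  pow-one-k = lift (≡.trans (≡.cong (_% k) (lower-pow-one k)) (n%n≡0 k))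

  pow-one-≉ε : ∀ {m} → 0 < m → m < k → ¬ Group._≈_ ℤ/k (pow ℤ/k (lift 1) m) (Group.ε ℤ/k)
  pow-one-≉ε {m = m} 0<m m<k (lift 1ᵐ%k≡0) = ℕ.<-irrefl (≡.sym m≡0) 0<m
    where
    m≡0 : m ≡ 0
    m≡0 = ≡.trans (≡.sym (m<n⇒m%n≡m m<k))
            (≡.trans (≡.cong (_% k) (≡.sym (lower-pow-one m))) 1ᵐ%k≡0)

generator-order : ∀ {d n} {G : Group c ℓ} {α : Fin (suc d) → Group.Carrier G} →
                  IsGdk G d (suc n) α →
                  ∀ i {m} → 0 < m → m < suc n → ¬ Group._≈_ G (pow G (α i) m) (Group.ε G)
generator-order {c = c} {ℓ = ℓ} {n = n} {G} {α} gdk i {m} 0<m m<k αᵢᵐ≈ε = pow-one-≉ε 0<m m<k (begin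
    pow ℤ/k (lift 1) m        ≈⟨ pow-cong m (f-α i) ⟨
    pow ℤ/k (f (α i)) m       ≈⟨ pow-homo G ℤ/k f-homo (α i) m ⟨
    f (pow G (α i) m)         ≈⟨ ⟦⟧-cong αᵢᵐ≈ε ⟩
    f (Group.ε G)             ≈⟨ ε-homo ⟩
    Group.ε ℤ/k               ∎)
  where
  open IntegersModulo c ℓ n
  open PowerProperties ℤ/k using (pow-cong)
  open import Relation.Binary.Reasoning.Setoid (Group.setoid ℤ/k)
  universal = IsGdk.existence gdk ℤ/k (λ _ → lift 1) (λ _ → pow-one-k)
  f = proj₁ universal
  f-homo = proj₁ (proj₂ universal)
  f-α = proj₂ (proj₂ universal)
  open GroupMorphisms.IsGroupHomomorphism f-homo using (⟦⟧-cong; ε-homo)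

module Cosets (G : Group c ℓ) where
  open Group G
  open import Algebra.Properties.Group G using (⁻¹-anti-homo-//; \\-leftDividesʳ; ε⁻¹≈ε)
  open PowerProperties G

  x//y∙y//z≈x//z : ∀ x y z → (x // y) ∙ (y // z) ≈ x // z
  x//y∙y//z≈x//z x y z = trans (assoc _ _ _) (∙-congˡ (\\-leftDividesʳ y (z ⁻¹)))

  RCoset-≐ : ∀ {p} {K : Carrier → Set p} → IsSubgroup G K →
             ∀ {u v} → K (u // v) → _≐_ G (RCoset G K u) (RCoset G K v)
  RCoset-≐ K-sub {u} {v} u//v∈K z =
      (λ z//u∈K → resp (x//y∙y//z≈x//z z u v) (∙∈ z//u∈K u//v∈K))
    , (λ z//v∈K → resp (x//y∙y//z≈x//z z v u) (∙∈ z//v∈K (resp (⁻¹-anti-homo-// u v) (⁻¹∈ u//v∈K))))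
    where open IsSubgroup K-sub

  Triv-isSubgroup : IsSubgroup G (Triv G)
  Triv-isSubgroup = record
    { resp = λ x≈y x≈ε → trans (sym x≈y) x≈ε
    ; ε∈   = refl
    ; ∙∈   = λ x≈ε y≈ε → trans (∙-cong x≈ε y≈ε) (identityˡ ε)
    ; ⁻¹∈  = λ x≈ε → trans (⁻¹-cong x≈ε) ε⁻¹≈ε
    }

  Cyc-isSubgroup : ∀ {a} n → pow G a (suc n) ≈ ε → IsSubgroup G (Cyc G a)
  Cyc-isSubgroup {a} n aᵏ≈ε = record
    { resp = λ x≈y (m , x≈aᵐ) → m , trans (sym x≈y) x≈aᵐ
    ; ε∈   = 0 , refl
    ; ∙∈   = λ (m , x≈aᵐ) (m' , y≈aᵐ') → m + m' , trans (∙-cong x≈aᵐ y≈aᵐ') (sym (pow-+ a m m'))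
    ; ⁻¹∈  = λ (m , x≈aᵐ) → n * m , trans (⁻¹-cong x≈aᵐ) (sym (inverseʳ-unique _ _ (aᵐ∙aⁿᵐ≈ε m)))
    }
    where
    open import Algebra.Properties.Group G using (inverseʳ-unique)
    open import Relation.Binary.Reasoning.Setoid setoid
    aᵐ∙aⁿᵐ≈ε : ∀ m → pow G a m ∙ pow G a (n * m) ≈ ε
    aᵐ∙aⁿᵐ≈ε m = begin
      pow G a m ∙ pow G a (n * m)   ≈⟨ pow-+ a m (n * m) ⟨
      pow G a (suc n * m)           ≈⟨ pow-congˡ a (ℕ.*-comm (suc n) m) ⟩
      pow G a (m * suc n)           ≈⟨ pow-* a m (suc n) ⟩
      pow G (pow G a (suc n)) m     ≈⟨ pow-cong m aᵏ≈ε ⟩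
      pow G ε m                     ≈⟨ pow-ε m ⟩
      ε                             ∎

module SameCoset (G : Group c ℓ) {H : Group.Carrier G → Set h} (H-sub : IsSubgroup G H) where
  open Group G
  open IsSubgroup H-sub
  open import Algebra.Properties.Group G using (x≈z//y; ∙-cancelˡ; //-rightDividesˡ)
  open PowerProperties G

  infix 4 _∼_
  _∼_ : Carrier → Carrier → Set (c ⊔ ℓ ⊔ h)
  u ∼ v = ∃ λ y → H y × u ≈ v ∙ y

  ∼-reflexive : ∀ {u v} → u ≈ v → u ∼ v
  ∼-reflexive u≈v = ε , ε∈ , trans u≈v (sym (identityʳ _))

  ∼-sym : ∀ {u v} → u ∼ v → v ∼ u
  ∼-sym {u} {v} (y , y∈H , u≈vy) = y ⁻¹ , ⁻¹∈ y∈H , x≈z//y v y u (sym u≈vy)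

  ∼-trans : ∀ {u v w} → u ∼ v → v ∼ w → u ∼ w
  ∼-trans (y , y∈H , u≈vy) (y' , y'∈H , v≈wy') =
    y' ∙ y , ∙∈ y'∈H y∈H , trans u≈vy (trans (∙-congʳ v≈wy') (assoc _ _ _))

  ∼-congˡ : ∀ x {u v} → u ∼ v → x ∙ u ∼ x ∙ v
  ∼-congˡ x (y , y∈H , u≈vy) = y , y∈H , trans (∙-congˡ u≈vy) (sym (assoc _ _ _))

  ∼-cancelˡ : ∀ x {u v} → x ∙ u ∼ x ∙ v → u ∼ v
  ∼-cancelˡ x {u} {v} (y , y∈H , xu≈xvy) = y , y∈H , ∙-cancelˡ x u (v ∙ y) (trans xu≈xvy (assoc _ _ _))

  ∼-fixed⇒conjugate : ∀ {x g} → x ∙ g ∼ g → ∃ λ y → H y × x ≈ g ∙ y ∙ g ⁻¹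
  ∼-fixed⇒conjugate {x} {g} (y , y∈H , xg≈gy) = y , y∈H , x≈z//y x g (g ∙ y) xg≈gy

  conjugate⇒∼-fixed : ∀ {x g} → (∃ λ y → H y × x ≈ g ∙ y ∙ g ⁻¹) → x ∙ g ∼ g
  conjugate⇒∼-fixed {x} {g} (y , y∈H , x≈gyg⁻¹) =
    y , y∈H , trans (∙-congʳ x≈gyg⁻¹) (//-rightDividesˡ g (g ∙ y))

  pow-∼-fixed : ∀ {x g} → x ∙ g ∼ g → ∀ q → pow G x q ∙ g ∼ g
  pow-∼-fixed xg∼g zero    = ∼-reflexive (identityˡ _)
  pow-∼-fixed {x} xg∼g (suc q) =
    ∼-trans (∼-reflexive (assoc _ _ _)) (∼-trans (∼-congˡ x (pow-∼-fixed xg∼g q)) xg∼g)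

  pow-∼-residue : ∀ {a g j} .{{_ : NonZero j}} → pow G a j ∙ g ∼ g →
                  ∀ m → pow G a m ∙ g ∼ pow G a (toℕ (fromℕ< (m%n<n m j))) ∙ g
  pow-∼-residue {a} {g} {j} aʲg∼g m =
    ∼-trans (∼-reflexive (trans (∙-congʳ (pow-divMod a m j)) (assoc _ _ _)))
     (∼-trans (∼-congˡ _ (pow-∼-fixed aʲg∼g (m / j)))
      (∼-reflexive (∙-congʳ (pow-congˡ a (≡.sym (Fin.toℕ-fromℕ< (m%n<n m j)))))))

module Regularity (G : Group c ℓ) {H : Group.Carrier G → Set h} (H-sub : IsSubgroup G H)
                  {d : ℕ} (α : Fin (suc d) → Group.Carrier G) (n : ℕ) (gdk : IsGdk G d (suc n) α) where
  open Group G
  open IsSubgroup H-sub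
  open IsGdk gdk using (relation)
  open import Algebra.Properties.Group G
    using (x∙y⁻¹≈ε⇒x≈y; x≈y⇒x∙y⁻¹≈ε; \\-leftDividesˡ; //-rightDividesˡ; //-rightDividesʳ; ε⁻¹≈ε)
  open import Relation.Binary.Reasoning.Setoid setoid
  open PowerProperties G
  open Cosets G
  open SameCoset G H-sub

  private
    k : ℕ
    k = suc n

  TopEq⇒∼ : ∀ {u v} → TopEq G H α u v → u ∼ v
  TopEq⇒∼ {u} {v} (forth , _) with forth ε ε∈
  ... | y , y∈H , cosets≐ =
    y , y∈H , trans (sym (identityʳ u)) (x∙y⁻¹≈ε⇒x≈y _ _ (proj₁ (cosets≐ (u ∙ ε)) (inverseʳ (u ∙ ε))))

  ∼⇒TopEq : ∀ {u v} → u ∼ v → TopEq G H α u v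
  ∼⇒TopEq {u} {v} (y , y∈H , u≈vy) =
      (λ x x∈H → y ∙ x , ∙∈ y∈H x∈H , same-coset (trans (∙-congʳ u≈vy) (assoc _ _ _)))
    , (λ x x∈H → y ⁻¹ ∙ x , ∙∈ (⁻¹∈ y∈H) x∈H , same-coset (begin
        u ∙ (y ⁻¹ ∙ x)         ≈⟨ ∙-congʳ u≈vy ⟩
        (v ∙ y) ∙ (y ⁻¹ ∙ x)   ≈⟨ assoc _ _ _ ⟩
        v ∙ (y ∙ (y ⁻¹ ∙ x))   ≈⟨ ∙-congˡ (\\-leftDividesˡ y x) ⟩
        v ∙ x                  ∎))
    where
    same-coset : ∀ {a b} → a ≈ b → _≐_ G (RCoset G (Triv G) a) (RCoset G (Triv G) b)
    same-coset = RCoset-≐ Triv-isSubgroup ∘ x≈y⇒x∙y⁻¹≈ε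

  contains-pow : ∀ i g m → Contains G H α (pow G (α i) m ∙ g) i g
  contains-pow i g m = i , (λ x x∈H → x , x∈H , absorb x) , (λ x x∈H → x , x∈H , absorb x)
    where
    absorb : ∀ x → _≐_ G (RCoset G (Cyc G (α i)) ((pow G (α i) m ∙ g) ∙ x)) (RCoset G (Cyc G (α i)) (g ∙ x))
    absorb x = RCoset-≐ (Cyc-isSubgroup n (relation i))
                 (m , trans (∙-congʳ (assoc _ _ _)) (//-rightDividesʳ (g ∙ x) (pow G (α i) m)))

  contains⇒∼pow : ∀ {g' i g} → Contains G H α g' i g → ∃ λ m → g' ∼ pow G (α i) m ∙ g
  contains⇒∼pow {g'} {i} {g} (_ , forth , _) with forth ε ε∈
  ... | y , y∈H , cosets≐ with proj₁ (cosets≐ (g' ∙ ε)) (0 , inverseʳ (g' ∙ ε))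
  ... | m , g'//gy≈αᵢᵐ = m , y , y∈H , (begin
    g'                              ≈⟨ identityʳ g' ⟨
    g' ∙ ε                          ≈⟨ //-rightDividesˡ (g ∙ y) (g' ∙ ε) ⟨
    ((g' ∙ ε) // (g ∙ y)) ∙ (g ∙ y) ≈⟨ ∙-congʳ g'//gy≈αᵢᵐ ⟩
    pow G (α i) m ∙ (g ∙ y)         ≈⟨ assoc _ _ _ ⟨
    (pow G (α i) m ∙ g) ∙ y         ∎)

  generator-power-cases : ∀ i {x} → Cyc G (α i) x →
                          x ≈ ε ⊎ ∃ λ j → 0 < j × j < k × x ≈ pow G (α i) j
  generator-power-cases i (m , x≈αᵢᵐ) with m % k in m%k≡r
  ... | zero  = inj₁ (trans x≈αᵢᵐ (trans (pow-mod (relation i) m) (pow-congˡ _ m%k≡r)))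
  ... | suc r = inj₂ (suc r , s≤s z≤n , ≡.subst (_< k) m%k≡r (m%n<n m k)
                     , trans x≈αᵢᵐ (trans (pow-mod (relation i) m) (pow-congˡ _ m%k≡r)))

  power-cells-distinct : ConjCondition G H α → ∀ i g {m m'} → m < m' → m' < k →
                         ¬ (pow G (α i) m ∙ g ∼ pow G (α i) m' ∙ g)
  power-cells-distinct conj i g {m} {m'} m<m' m'<k cells∼ =
    generator-order gdk i (ℕ.m<n⇒0<n∸m m<m') (ℕ.≤-<-trans (ℕ.m∸n≤m m' m) m'<k)
      (conj i g _ (δ , refl) (∼-fixed⇒conjugate (∼-sym (∼-cancelˡ (pow G a m) shifted))))
    where
    a = α i
    δ = m' ∸ m
    shifted : pow G a m ∙ g ∼ pow G a m ∙ (pow G a δ ∙ g)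
    shifted = ∼-trans cells∼ (∼-reflexive (begin
      pow G a m' ∙ g                ≈⟨ ∙-congʳ (pow-congˡ a (≡.sym (ℕ.m+[n∸m]≡n (ℕ.<⇒≤ m<m')))) ⟩
      pow G a (m + δ) ∙ g           ≈⟨ ∙-congʳ (pow-+ a m δ) ⟩
      (pow G a m ∙ pow G a δ) ∙ g   ≈⟨ assoc _ _ _ ⟩
      pow G a m ∙ (pow G a δ ∙ g)   ∎))

  ConjCondition⇒UpperRegular : ConjCondition G H α → UpperRegular G H α k
  ConjCondition⇒UpperRegular conj i g = cell , (contains-pow i g ∘ toℕ) , injective , surjective
    where
    cell : Fin k → Carrier
    cell m = pow G (α i) (toℕ m) ∙ g

    injective : ∀ m m' → TopEq G H α (cell m) (cell m') → m ≡ m'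
    injective m m' top with ℕ.<-cmp (toℕ m) (toℕ m')
    ... | tri< m<m' _ _ = ⊥-elim (power-cells-distinct conj i g m<m' (Fin.toℕ<n m') (TopEq⇒∼ top))
    ... | tri≈ _ m≡m' _ = Fin.toℕ-injective m≡m'
    ... | tri> _ _ m'<m = ⊥-elim (power-cells-distinct conj i g m'<m (Fin.toℕ<n m) (∼-sym (TopEq⇒∼ top)))

    surjective : ∀ g' → Contains G H α g' i g → ∃ λ m → TopEq G H α g' (cell m)
    surjective g' g'-contains with contains⇒∼pow g'-contains
    ... | m , g'∼αᵢᵐg =
      fromℕ< (m%n<n m k) , ∼⇒TopEq (∼-trans g'∼αᵢᵐg (pow-∼-residue (∼-reflexive αᵢᵏg≈g) m))
      where
      αᵢᵏg≈g : pow G (α i) k ∙ g ≈ g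
      αᵢᵏg≈g = trans (∙-congʳ (relation i)) (identityˡ g)

  fixing-power⇒¬regular : ∀ i g {j} .{{_ : NonZero j}} → j < k → pow G (α i) j ∙ g ∼ g →
                           ¬ ContainedInExactly G H α k i g
  fixing-power⇒¬regular i g {j} j<k αᵢʲg∼g (cell , contains , injective , _) =
    no-collision (Fin.pigeonhole j<k residue)
    where
    exponent : Fin k → ℕ
    exponent m = proj₁ (contains⇒∼pow (contains m))

    residue : Fin k → Fin j
    residue m = fromℕ< (m%n<n (exponent m) j)

    cell∼residue : ∀ m → cell m ∼ pow G (α i) (toℕ (residue m)) ∙ g
    cell∼residue m = ∼-trans (proj₂ (contains⇒∼pow (contains m))) (pow-∼-residue αᵢʲg∼g (exponent m))

    no-collision : ¬ ∃₂ λ m m' → m Fin.< m' × residue m ≡ residue m'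
    no-collision (m , m' , m<m' , same-residue) = Fin.<-irrefl (injective m m' (∼⇒TopEq cells∼)) m<m'
      where
      cells∼ : cell m ∼ cell m'
      cells∼ = ∼-trans (cell∼residue m)
                 (∼-trans (∼-reflexive (reflexive (≡.cong (λ r → pow G (α i) (toℕ r) ∙ g) same-residue)))
                   (∼-sym (cell∼residue m')))

  UpperRegular⇒ConjCondition : UpperRegular G H α k → ConjCondition G H α
  UpperRegular⇒ConjCondition regular i g x x∈⟨αᵢ⟩ x∈gHg⁻¹ with generator-power-cases i x∈⟨αᵢ⟩
  ... | inj₁ x≈ε = x≈ε
  ... | inj₂ (j , 0<j , j<k , x≈αᵢʲ) =
    ⊥-elim (fixing-power⇒¬regular i g {{>-nonZero 0<j}} j<k
              (∼-trans (∼-reflexive (∙-congʳ (sym x≈αᵢʲ))) (conjugate⇒∼-fixed x∈gHg⁻¹))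
              (regular i g))

  ConjCondition⇒IntersectCondition : ConjCondition G H α → IntersectCondition G H α
  ConjCondition⇒IntersectCondition conj i x x∈⟨αᵢ⟩ x∈H =
    conj i ε x x∈⟨αᵢ⟩ (x , x∈H , sym (trans (∙-cong (identityˡ x) ε⁻¹≈ε) (identityʳ x)))

  IntersectCondition⇒ConjCondition : IsNormal G H → IntersectCondition G H α → ConjCondition G H α
  IntersectCondition⇒ConjCondition normal intersect i g x x∈⟨αᵢ⟩ (y , y∈H , x≈gyg⁻¹) =
    intersect i x x∈⟨αᵢ⟩ (resp (sym x≈gyg⁻¹) (normal g y y∈H))

  IntersectCondition⇒QuotientOrder : IntersectCondition G H α → QuotientOrder G H α k
  IntersectCondition⇒QuotientOrder intersect i =
      resp (sym (relation i)) ε∈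
    , λ j 0<j j<k αᵢʲ∈H → generator-order gdk i 0<j j<k (intersect i _ (j , refl) αᵢʲ∈H)

  QuotientOrder⇒IntersectCondition : QuotientOrder G H α k → IntersectCondition G H α
  QuotientOrder⇒IntersectCondition order i x x∈⟨αᵢ⟩ x∈H with generator-power-cases i x∈⟨αᵢ⟩
  ... | inj₁ x≈ε = x≈ε
  ... | inj₂ (j , 0<j , j<k , x≈αᵢʲ) = ⊥-elim (proj₂ (order i) j 0<j j<k (resp x≈αᵢʲ x∈H))

lemma9p6 : {c ℓ h : Level} (d k : ℕ) → 2 ≤ k →
    (G : Group c ℓ) (α : Fin (suc d) → Group.Carrier G) → IsGdk G d k α →
    (H : Group.Carrier G → Set h) → IsSubgroup G H →
    (UpperRegular G H α k ⇔ ConjCondition G H α)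
    × (IsNormal G H →
    (UpperRegular G H α k ⇔ IntersectCondition G H α)
    × (IntersectCondition G H α ⇔ QuotientOrder G H α k))
lemma9p6 d (suc n) (s≤s _) G α gdk H H-sub =
    mk⇔ UpperRegular⇒ConjCondition ConjCondition⇒UpperRegular
  , λ normal →
      mk⇔ (ConjCondition⇒IntersectCondition ∘ UpperRegular⇒ConjCondition)
          (ConjCondition⇒UpperRegular ∘ IntersectCondition⇒ConjCondition normal)
    , mk⇔ IntersectCondition⇒QuotientOrder QuotientOrder⇒IntersectCondition
  where open Regularity G H-sub α n gdk
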